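{- Every finite digraph is majority $4$-choosable: for every finite digraph $D$ and every assignment of a list $L(v)$ of $4$ colors to each vertex $v$, there is a coloring $c$ with $c(v) \in L(v)$ for all $v$ such that for every vertex $v$, the number of out-neighbors of $v$ colored $c(v)$ is at most $\frac{1}{2} d^+(v)$.
   Context: For a vertex $v$ of a digraph, $d^+(v)$ denotes the number of out-neighbors of $v$. A majority coloring of a digraph is a vertex coloring in which, for every vertex $v$, at most $\frac12 d^+(v)$ out-neighbors of $v$ have the same color as $v$. A digraph is majority $k$-choosable if for any assignment of lists of $k$ colors to its vertices there is a majority coloring in which each vertex receives a color from its list. -}

module Defs where

open import Data.Nat using (ℕ; _*_; _≤_)
open import Data.Bool using (Bool; true; false; _∧_)
open import Data.Fin using (Fin)
open import Data.List using (List; length; filter; allFin)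
open import Data.Product using (Σ; _×_; _,_)
open import Relation.Binary.PropositionalEquality using (_≡_; _≢_)
open import Relation.Nullary.Decidable using (⌊_⌋)
open import Relation.Unary using (Decidable)
open import Function.Definitions using (Injective)
open import Data.Bool.Properties using () renaming (_≟_ to _≟ᵇ_)
import Data.Nat as ℕ

-- A finite digraph on vertex set Fin n: a loopless arc relation
-- (no multiple arcs; antiparallel arcs u→v and v→u allowed).
record Digraph (n : ℕ) : Set where
  field
    arc      : Fin n → Fin n → Bool
    loopless : ∀ v → arc v v ≡ false
open Digraph public

outNbrs : ∀ {n} → Digraph n → Fin n → List (Fin n)
outNbrs D v = filter (λ u → arc D v u ≟ᵇ true) (allFin _)

outDeg : ∀ {n} → Digraph n → Fin n → ℕ
outDeg D v = length (outNbrs D v)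

Colouring : ℕ → Set
Colouring n = Fin n → ℕ

sameOut : ∀ {n} → Digraph n → Colouring n → Fin n → ℕ
sameOut D c v = length (filter (λ u → c u ℕ.≟ c v) (outNbrs D v))

IsMajorityColouring : ∀ {n} → Digraph n → Colouring n → Set
IsMajorityColouring D c = ∀ v → 2 * sameOut D c v ≤ outDeg D v

ListAssignment : ℕ → ℕ → Set
ListAssignment k n = Σ (Fin n → Fin k → ℕ) (λ L → ∀ v → Injective _≡_ _≡_ (L v))

_respects_ : ∀ {k n} → Colouring n → ListAssignment k n → Set
_respects_ {k} {n} c (L , _) = ∀ (v : Fin n) → Σ (Fin k) (λ i → L v i ≡ c v)

MajorityChoosable : ℕ → ∀ {n} → Digraph n → Set
MajorityChoosable k {n} D =
  (L : ListAssignment k n) → Σ (Colouring n) (λ c → c respects L × IsMajorityColouring D c)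

module Submission where

-- Order the vertices by index; an arc v → u is forward if u < v and backward if v < u.
-- Going up the order, each v keeps two colours S(v) ⊆ L(v) such that at most d₁(v) pairs
-- (u, x) have u a forward out-neighbour and x ∈ S(u) ∩ S(v), where d₁(v) counts forward arcs:
-- each S(u) contains at most two of the four colours of L(v), so the two halves of L(v)
-- together carry at most 2 d₁(v) such pairs.  Going down the order, v then takes the colour
-- x ∈ S(v) minimising the number of forward out-neighbours u with x ∈ S(u) plus backward
-- out-neighbours (already coloured) coloured x; the two candidates score at most d⁺(v) in
-- total, so x scores at most d⁺(v)/2.  Since every u is coloured from S(u), this score
-- bounds the number of out-neighbours of v sharing its colour.

open import Defs
open import Data.Bool using (Bool; true; false; T; _∧_; _∨_; if_then_else_)
open import Data.Bool.Properties using (T-∧; T-∨) renaming (_≟_ to _≟ᵇ_)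
open import Data.Empty using (⊥; ⊥-elim)
open import Data.Fin as Fin using (Fin; zero; suc; toℕ; opposite)
open import Data.Fin.Patterns using (0F; 1F; 2F; 3F)
import Data.Fin.Properties as Fin
open import Data.List using (List; []; _∷_; length; filter; tabulate; allFin)
open import Data.Nat using (ℕ; zero; suc; _+_; _*_; _≤_; _<_; z≤n; s≤s; s≤s⁻¹; _≡ᵇ_; _≤?_)
import Data.Nat as ℕ
open import Data.Nat.Properties
open import Algebra.Properties.CommutativeMonoid.Sum +-0-commutativeMonoid
  using (sum-syntax; sum-cong-≗; ∑-distrib-+; ∑-comm)
open import Data.Product using (∃; ∃₂; _×_; _,_; proj₁; proj₂)
open import Data.Sum using (_⊎_; inj₁; inj₂; [_,_]; [_,_]′)
open import Data.Vec.Functional using (updateAt)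
open import Data.Vec.Functional.Properties using (updateAt-updates; updateAt-minimal)
open import Function using (_∘_; id; const; Equivalence)
open import Function.Definitions using (Injective)
open import Relation.Binary.PropositionalEquality
  using (_≡_; _≢_; refl; sym; trans; cong; cong₂; subst; module ≡-Reasoning)
open import Relation.Binary.Definitions using (tri<; tri≈; tri>)
open import Relation.Nullary using (¬_; does; yes; no)
open import Relation.Nullary.Decidable using (⌊_⌋; toWitness; fromWitness; _×-dec_)
open import Relation.Unary using (Pred; Decidable)
open import Algebra.Properties.CommutativeSemigroup +-commutativeSemigroup using (interchange)

open Equivalence using (to; from)

𝟙 : Bool → ℕ
𝟙 b = if b then 1 else 0

count : ∀ {n} → (Fin n → Bool) → ℕ
count {n} P = ∑[ i < n ] 𝟙 (P i)

∑-mono-≤ : ∀ {n} {f g : Fin n → ℕ} → (∀ i → f i ≤ g i) → ∑[ i < n ] f i ≤ ∑[ i < n ] g i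
∑-mono-≤ {zero}  _   = z≤n
∑-mono-≤ {suc n} f≤g = +-mono-≤ (f≤g zero) (∑-mono-≤ (f≤g ∘ suc))

count-⊎ : ∀ {n} {P Q R : Fin n → Bool} → (∀ i → T (R i) → T (P i) ⊎ T (Q i)) →
          count R ≤ count P + count Q
count-⊎ {P = P} {Q} {R} cover =
  ≤-trans (∑-mono-≤ (λ i → 𝟙-⊎ (R i) (P i) (Q i) (cover i)))
          (≤-reflexive (∑-distrib-+ (𝟙 ∘ P) (𝟙 ∘ Q)))
  where
  𝟙-⊎ : ∀ r p q → (T r → T p ⊎ T q) → 𝟙 r ≤ 𝟙 p + 𝟙 q
  𝟙-⊎ false _     _     _ = z≤n
  𝟙-⊎ true  true  _     _ = s≤s z≤n
  𝟙-⊎ true  false true  _ = ≤-refl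
  𝟙-⊎ true  false false h with h _
  ... | inj₁ ()
  ... | inj₂ ()

count-disjoint : ∀ {n} {P Q R : Fin n → Bool} → (∀ i → T (P i) → T (Q i) → ⊥) →
                 (∀ i → T (P i) ⊎ T (Q i) → T (R i)) → count P + count Q ≤ count R
count-disjoint {P = P} {Q} {R} disjoint into =
  ≤-trans (≤-reflexive (sym (∑-distrib-+ (𝟙 ∘ P) (𝟙 ∘ Q))))
          (∑-mono-≤ (λ i → 𝟙-disjoint (P i) (Q i) (R i) (disjoint i) (into i)))
  where
  𝟙-disjoint : ∀ p q r → (T p → T q → ⊥) → (T p ⊎ T q → T r) → 𝟙 p + 𝟙 q ≤ 𝟙 r
  𝟙-disjoint false false _     _  _ = z≤n
  𝟙-disjoint true  true  _     pq _ = ⊥-elim (pq _ _)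
  𝟙-disjoint true  false true  _  _ = ≤-refl
  𝟙-disjoint false true  true  _  _ = ≤-refl
  𝟙-disjoint true  false false _  i = ⊥-elim (i (inj₁ _))
  𝟙-disjoint false true  false _  i = ⊥-elim (i (inj₂ _))

count-none : ∀ {n} (P : Fin n → Bool) → (∀ i → ¬ T (P i)) → count P ≡ 0
count-none {zero}  P _    = refl
count-none {suc n} P none with P zero in P₀
... | true  = ⊥-elim (none zero (subst T (sym P₀) _))
... | false = count-none (P ∘ suc) (none ∘ suc)

count-≤1 : ∀ {n} (P : Fin n → Bool) → (∀ {i j} → T (P i) → T (P j) → i ≡ j) → count P ≤ 1
count-≤1 {zero}  P _      = z≤n
count-≤1 {suc n} P unique with P zero in P₀
... | true  = ≤-reflexive (cong suc (count-none (P ∘ suc)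
                (λ i Pi → Fin.0≢1+n (unique (subst T (sym P₀) _) Pi))))
... | false = count-≤1 (P ∘ suc) (λ Pi Pj → Fin.suc-injective (unique Pi Pj))

count-∧-cong : ∀ {n} (P : Fin n → Bool) {Q Q′ : Fin n → Bool} → (∀ i → T (P i) → Q i ≡ Q′ i) →
               count (λ i → P i ∧ Q i) ≡ count (λ i → P i ∧ Q′ i)
count-∧-cong P eq = sum-cong-≗ (λ i → 𝟙-∧-cong (P i) (eq i))
  where
  𝟙-∧-cong : ∀ p {q q′} → (T p → q ≡ q′) → 𝟙 (p ∧ q) ≡ 𝟙 (p ∧ q′)
  𝟙-∧-cong false _ = refl
  𝟙-∧-cong true  e = cong 𝟙 (e _)

_∈ᵖ_ : ℕ → ℕ × ℕ → Bool
x ∈ᵖ (p , q) = (x ≡ᵇ p) ∨ (x ≡ᵇ q)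

∈ᵖ-fst : ∀ p q → T (p ∈ᵖ (p , q))
∈ᵖ-fst p q = from T-∨ (inj₁ (≡⇒≡ᵇ p p refl))

∈ᵖ-snd : ∀ p q → T (q ∈ᵖ (p , q))
∈ᵖ-snd p q = from T-∨ (inj₂ (≡⇒≡ᵇ q q refl))

∈ᵖ⇒≡⊎≡ : ∀ {x} s → T (x ∈ᵖ s) → x ≡ proj₁ s ⊎ x ≡ proj₂ s
∈ᵖ⇒≡⊎≡ {x} (p , q) = [ inj₁ ∘ ≡ᵇ⇒≡ x p , inj₂ ∘ ≡ᵇ⇒≡ x q ] ∘ to T-∨

count-≡ᵇ-≤1 : ∀ {n} {g : Fin n → ℕ} → Injective _≡_ _≡_ g → ∀ x → count (λ i → g i ≡ᵇ x) ≤ 1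
count-≡ᵇ-≤1 {g = g} g-injective x =
  count-≤1 _ (λ {i} {j} gi gj → g-injective (trans (≡ᵇ⇒≡ (g i) x gi) (sym (≡ᵇ⇒≡ (g j) x gj))))

count-∈ᵖ-≤2 : ∀ {n} {g : Fin n → ℕ} → Injective _≡_ _≡_ g → ∀ s → count (λ i → g i ∈ᵖ s) ≤ 2
count-∈ᵖ-≤2 {g = g} g-injective (p , q) =
  ≤-trans (count-⊎ {P = λ i → g i ≡ᵇ p} {Q = λ i → g i ≡ᵇ q} (λ _ → to T-∨))
          (+-mono-≤ (count-≡ᵇ-≤1 g-injective p) (count-≡ᵇ-≤1 g-injective q))

filter-filter : ∀ {a p q} {A : Set a} {P : Pred A p} {Q : Pred A q}
                (P? : Decidable P) (Q? : Decidable Q) (xs : List A) →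
                filter Q? (filter P? xs) ≡ filter (λ x → P? x ×-dec Q? x) xs
filter-filter P? Q? [] = refl
filter-filter P? Q? (x ∷ xs) with does (P? x)
... | false = filter-filter P? Q? xs
... | true with does (Q? x)
...   | true  = cong (x ∷_) (filter-filter P? Q? xs)
...   | false = filter-filter P? Q? xs

length-filter-tabulate : ∀ {a p} {A : Set a} {P : Pred A p} (P? : Decidable P) {n} (f : Fin n → A) →
                         length (filter P? (tabulate f)) ≡ count (λ i → does (P? (f i)))
length-filter-tabulate P? {zero}  f = refl
length-filter-tabulate P? {suc n} f with does (P? (f zero))
... | true  = cong suc (length-filter-tabulate P? (f ∘ suc))
... | false = length-filter-tabulate P? (f ∘ suc)

does-≟-true : ∀ b → does (b ≟ᵇ true) ≡ b
does-≟-true false = refl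
does-≟-true true  = refl

outDeg≡count : ∀ {n} (D : Digraph n) v → outDeg D v ≡ count (arc D v)
outDeg≡count D v =
  trans (length-filter-tabulate (λ u → arc D v u ≟ᵇ true) id)
        (sum-cong-≗ (cong 𝟙 ∘ does-≟-true ∘ arc D v))

sameOut≡count : ∀ {n} (D : Digraph n) (c : Colouring n) v →
                sameOut D c v ≡ count (λ u → arc D v u ∧ (c u ≡ᵇ c v))
sameOut≡count {n} D c v = begin
  sameOut D c v
    ≡⟨ cong length (filter-filter (λ u → arc D v u ≟ᵇ true) (λ u → c u ℕ.≟ c v) (allFin n)) ⟩
  length (filter (λ u → (arc D v u ≟ᵇ true) ×-dec (c u ℕ.≟ c v)) (tabulate id))
    ≡⟨ length-filter-tabulate (λ u → (arc D v u ≟ᵇ true) ×-dec (c u ℕ.≟ c v)) id ⟩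
  count (λ u → does (arc D v u ≟ᵇ true) ∧ (c u ≡ᵇ c v))
    ≡⟨ sum-cong-≗ (λ u → cong (λ b → 𝟙 (b ∧ (c u ≡ᵇ c v))) (does-≟-true (arc D v u))) ⟩
  count (λ u → arc D v u ∧ (c u ≡ᵇ c v))
    ∎
  where open ≡-Reasoning

m+n≤o+p⇒m≤o⊎n≤p : ∀ {m n o p} → m + n ≤ o + p → m ≤ o ⊎ n ≤ p
m+n≤o+p⇒m≤o⊎n≤p {m} {n} {o} {p} le with m ≤? o
... | yes m≤o = inj₁ m≤o
... | no  m≰o = inj₂ (≮⇒≥ (λ p<n → ≤⇒≯ le (+-mono-< (≰⇒> m≰o) p<n)))

m+n≤o⇒2m≤o⊎2n≤o : ∀ {m n o} → m + n ≤ o → 2 * m ≤ o ⊎ 2 * n ≤ o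
m+n≤o⇒2m≤o⊎2n≤o {m} {n} le with m ≤? n
... | yes m≤n = inj₁ (≤-trans (≤-reflexive (cong (m +_) (+-identityʳ m)))
                              (≤-trans (+-monoʳ-≤ m m≤n) le))
... | no  m≰n = inj₂ (≤-trans (≤-reflexive (cong (n +_) (+-identityʳ n)))
                              (≤-trans (+-monoˡ-≤ n (<⇒≤ (≰⇒> m≰n))) le))

opposite-injective : ∀ {n} → Injective _≡_ _≡_ (opposite {n})
opposite-injective {x = i} {j} eq =
  trans (sym (Fin.opposite-involutive i)) (trans (cong opposite eq) (Fin.opposite-involutive j))

opposite-antitone : ∀ {n} {i j : Fin n} → i Fin.< j → opposite j Fin.≤ opposite i
opposite-antitone {n} {i} {j} i<j rewrite Fin.opposite-prop i | Fin.opposite-prop j =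
  ∸-monoʳ-≤ n (s≤s (<⇒≤ i<j))

module _ {n} {X : Set} (rank : Fin n → Fin n) (rank-injective : Injective _≡_ _≡_ rank)
         (Good : (Fin n → X) → Fin n → Set)
         (Good-local : ∀ {f g} v → (∀ u → rank u Fin.≤ rank v → f u ≡ g u) → Good f v → Good g v)
         (Good-extend : ∀ f v → ∃ λ x → Good (updateAt f v (const x)) v)
  where

  private
    good-below : X → ∀ m → ∃ λ f → ∀ v → toℕ (rank v) < m → Good f v
    good-below x₀ zero    = const x₀ , λ _ ()
    good-below x₀ (suc m) with good-below x₀ m | Fin.any? (λ v → toℕ (rank v) ℕ.≟ m)
    ... | f , good | no none = f , λ w r<1+m → good w (≤∧≢⇒< (s≤s⁻¹ r<1+m) (λ r≡m → none (w , r≡m)))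
    ... | f , good | yes (v , rv≡m) = f′ , good′
      where
      x = proj₁ (Good-extend f v)
      f′ = updateAt f v (const x)
      good′ : ∀ w → toℕ (rank w) < suc m → Good f′ w
      good′ w r<1+m with toℕ (rank w) ℕ.≟ m
      ... | yes rw≡m = subst (Good f′) (rank-injective (Fin.toℕ-injective (trans rv≡m (sym rw≡m))))
                             (proj₂ (Good-extend f v))
      ... | no  rw≢m = Good-local w unchanged (good w rw<m)
        where
        rw<m = ≤∧≢⇒< (s≤s⁻¹ r<1+m) rw≢m
        unchanged : ∀ u → rank u Fin.≤ rank w → f u ≡ f′ u
        unchanged u ru≤rw = sym (updateAt-minimal u v f
          (λ { refl → <-irrefl rv≡m (≤-<-trans ru≤rw rw<m) }))

  greedy : X → ∃ λ f → ∀ v → Good f v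
  greedy x₀ with good-below x₀ n
  ... | f , good = f , λ v → good v (Fin.toℕ<n (rank v))

module FourLists {n} (D : Digraph n) (L : Fin n → Fin 4 → ℕ)
                 (L-injective : ∀ v → Injective _≡_ _≡_ (L v)) where

  forward backward : Fin n → Fin n → Bool
  forward  v u = arc D v u ∧ ⌊ u Fin.<? v ⌋
  backward v u = arc D v u ∧ ⌊ v Fin.<? u ⌋

  forward⇒< : ∀ {v u} → T (forward v u) → u Fin.< v
  forward⇒< {v} {u} = toWitness ∘ proj₂ ∘ to (T-∧ {arc D v u})

  backward⇒> : ∀ {v u} → T (backward v u) → v Fin.< u
  backward⇒> {v} {u} = toWitness ∘ proj₂ ∘ to (T-∧ {arc D v u})

  arc⇒forward⊎backward : ∀ v u → T (arc D v u) → T (forward v u) ⊎ T (backward v u)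
  arc⇒forward⊎backward v u a with Fin.<-cmp u v
  ... | tri< u<v _ _ = inj₁ (from T-∧ (a , fromWitness u<v))
  ... | tri≈ _ refl _ = ⊥-elim (subst T (loopless D v) a)
  ... | tri> _ _ v<u = inj₂ (from T-∧ (a , fromWitness v<u))

  d₁ d₂ : Fin n → ℕ
  d₁ v = count (forward v)
  d₂ v = count (backward v)

  d₁+d₂≤outDeg : ∀ v → d₁ v + d₂ v ≤ outDeg D v
  d₁+d₂≤outDeg v = subst (d₁ v + d₂ v ≤_) (sym (outDeg≡count D v))
    (count-disjoint {P = forward v} {Q = backward v} {R = arc D v}
                    (λ u f b → Fin.<-asym (forward⇒< f) (backward⇒> b))
                    (λ u → [ proj₁ ∘ to T-∧ , proj₁ ∘ to T-∧ ]))

  forwardClashes : (Fin n → ℕ × ℕ) → Fin n → ℕ → ℕ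
  forwardClashes S v x = count (λ u → forward v u ∧ x ∈ᵖ S u)

  backwardClashes : (Fin n → ℕ) → Fin n → ℕ → ℕ
  backwardClashes c v x = count (λ u → backward v u ∧ (c u ≡ᵇ x))

  forwardClashes-local : ∀ S S′ v → (∀ u → u Fin.< v → S u ≡ S′ u) →
                         ∀ x → forwardClashes S v x ≡ forwardClashes S′ v x
  forwardClashes-local S S′ v agree x =
    count-∧-cong (forward v) (λ u f → cong (x ∈ᵖ_) (agree u (forward⇒< f)))

  backwardClashes-local : ∀ c c′ v → (∀ u → v Fin.< u → c u ≡ c′ u) →
                          ∀ x → backwardClashes c v x ≡ backwardClashes c′ v x
  backwardClashes-local c c′ v agree x =
    count-∧-cong (backward v) (λ u b → cong (_≡ᵇ x) (agree u (backward⇒> b)))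

  ∑-forwardClashes≤ : ∀ S v → ∑[ i < 4 ] forwardClashes S v (L v i) ≤ d₁ v + d₁ v
  ∑-forwardClashes≤ S v = begin
    ∑[ i < 4 ] ∑[ u < n ] 𝟙 (forward v u ∧ L v i ∈ᵖ S u)
      ≡⟨ ∑-comm (λ i u → 𝟙 (forward v u ∧ L v i ∈ᵖ S u)) ⟩
    ∑[ u < n ] ∑[ i < 4 ] 𝟙 (forward v u ∧ L v i ∈ᵖ S u)
      ≤⟨ ∑-mono-≤ (λ u → at-most-two (forward v u) (S u)) ⟩
    ∑[ u < n ] (𝟙 (forward v u) + 𝟙 (forward v u))
      ≡⟨ ∑-distrib-+ (𝟙 ∘ forward v) (𝟙 ∘ forward v) ⟩
    d₁ v + d₁ v
      ∎
    where
    open ≤-Reasoning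
    at-most-two : ∀ b s → ∑[ i < 4 ] 𝟙 (b ∧ L v i ∈ᵖ s) ≤ 𝟙 b + 𝟙 b
    at-most-two false _ = z≤n
    at-most-two true  s = count-∈ᵖ-≤2 (L-injective v) s

  GoodPair : (Fin n → ℕ × ℕ) → Fin n → Set
  GoodPair S v = ∃₂ λ i j → i ≢ j × S v ≡ (L v i , L v j) ×
                 forwardClashes S v (L v i) + forwardClashes S v (L v j) ≤ d₁ v

  GoodPair-local : ∀ {S S′} v → (∀ u → u Fin.≤ v → S u ≡ S′ u) → GoodPair S v → GoodPair S′ v
  GoodPair-local {S} {S′} v agree (i , j , i≢j , Sv≡ , clashes≤) =
    i , j , i≢j , trans (sym (agree v Fin.≤-refl)) Sv≡ ,
    subst (_≤ d₁ v) (cong₂ _+_ (earlier (L v i)) (earlier (L v j))) clashes≤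
    where earlier = forwardClashes-local S S′ v (λ u u<v → agree u (<⇒≤ u<v))

  GoodPair-extend : ∀ S v → ∃ λ s → GoodPair (updateAt S v (const s)) v
  GoodPair-extend S v =
    [ keep 0F 1F (λ ()) , keep 2F 3F (λ ()) ]′
      (m+n≤o+p⇒m≤o⊎n≤p (subst (_≤ d₁ v + d₁ v) regroup (∑-forwardClashes≤ S v)))
    where
    a : Fin 4 → ℕ
    a = forwardClashes S v ∘ L v
    regroup : ∑[ i < 4 ] a i ≡ (a 0F + a 1F) + (a 2F + a 3F)
    regroup = trans (cong (λ z → a 0F + (a 1F + (a 2F + z))) (+-identityʳ (a 3F)))
                    (sym (+-assoc (a 0F) (a 1F) _))
    keep : ∀ i j → i ≢ j → a i + a j ≤ d₁ v → ∃ λ s → GoodPair (updateAt S v (const s)) v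
    keep i j i≢j clashes≤ =
      (L v i , L v j) , i , j , i≢j , updateAt-updates v S ,
      subst (_≤ d₁ v) (sym (cong₂ _+_ (unchanged (L v i)) (unchanged (L v j)))) clashes≤
      where unchanged = forwardClashes-local (updateAt S v (const (L v i , L v j))) S v
                          (λ u u<v → updateAt-minimal u v S (Fin.<⇒≢ u<v))

  choosePairs : ∃ λ S → ∀ v → GoodPair S v
  choosePairs = greedy id id GoodPair GoodPair-local GoodPair-extend (0 , 0)

  module _ (S : Fin n → ℕ × ℕ) (S-good : ∀ v → GoodPair S v) where

    clashes : (Fin n → ℕ) → Fin n → ℕ → ℕ
    clashes c v x = forwardClashes S v x + backwardClashes c v x

    Fits : (Fin n → ℕ) → Fin n → ℕ → Set
    Fits c v x = T (x ∈ᵖ S v) × 2 * clashes c v x ≤ d₁ v + d₂ v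

    GoodColour : (Fin n → ℕ) → Fin n → Set
    GoodColour c v = Fits c v (c v)

    Fits-local : ∀ c c′ v → (∀ u → v Fin.< u → c u ≡ c′ u) → ∀ {x} → Fits c v x → Fits c′ v x
    Fits-local c c′ v agree {x} (x∈Sv , clashes≤) =
      x∈Sv , subst (λ y → 2 * (forwardClashes S v x + y) ≤ d₁ v + d₂ v)
                   (backwardClashes-local c c′ v agree x) clashes≤

    some-colour-fits : ∀ c v → ∃ λ x → Fits c v x
    some-colour-fits c v with S-good v
    ... | i , j , i≢j , Sv≡ , forward≤ =
      [ (λ 2p≤ → p , subst (λ s → T (p ∈ᵖ s)) (sym Sv≡) (∈ᵖ-fst p q) , 2p≤)
      , (λ 2q≤ → q , subst (λ s → T (q ∈ᵖ s)) (sym Sv≡) (∈ᵖ-snd p q) , 2q≤)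
      ]′ (m+n≤o⇒2m≤o⊎2n≤o {clashes c v p} total)
      where
      p = L v i
      q = L v j
      backward≤ : backwardClashes c v p + backwardClashes c v q ≤ d₂ v
      backward≤ = count-disjoint {P = λ u → backward v u ∧ (c u ≡ᵇ p)}
                                 {Q = λ u → backward v u ∧ (c u ≡ᵇ q)}
        (λ u cu≡p cu≡q → i≢j (L-injective v (trans (sym (≡ᵇ⇒≡ (c u) p (proj₂ (to T-∧ cu≡p))))
                                                    (≡ᵇ⇒≡ (c u) q (proj₂ (to T-∧ cu≡q))))))
        (λ u → [ proj₁ ∘ to T-∧ , proj₁ ∘ to T-∧ ])
      total : clashes c v p + clashes c v q ≤ d₁ v + d₂ v
      total = subst (_≤ d₁ v + d₂ v)
        (interchange (forwardClashes S v p) (forwardClashes S v q)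
                     (backwardClashes c v p) (backwardClashes c v q))
        (+-mono-≤ forward≤ backward≤)

    GoodColour-local : ∀ {c c′} v → (∀ u → opposite u Fin.≤ opposite v → c u ≡ c′ u) →
                       GoodColour c v → GoodColour c′ v
    GoodColour-local {c} {c′} v agree fits =
      subst (Fits c′ v) (agree v Fin.≤-refl)
            (Fits-local c c′ v (λ u v<u → agree u (opposite-antitone v<u)) fits)

    GoodColour-extend : ∀ c v → ∃ λ x → GoodColour (updateAt c v (const x)) v
    GoodColour-extend c v with some-colour-fits c v
    ... | x , fits = x , subst (Fits c′ v) (sym (updateAt-updates v c)) (Fits-local c c′ v later fits)
      where
      c′ = updateAt c v (const x)
      later : ∀ u → v Fin.< u → c u ≡ c′ u
      later u v<u = sym (updateAt-minimal u v c (Fin.<⇒≢ v<u ∘ sym))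

    chooseColours : ∃ λ c → ∀ v → GoodColour c v
    chooseColours = greedy opposite opposite-injective GoodColour GoodColour-local GoodColour-extend 0

    sameOut≤clashes : ∀ c → (∀ v → GoodColour c v) → ∀ v → sameOut D c v ≤ clashes c v (c v)
    sameOut≤clashes c good v = subst (_≤ clashes c v (c v)) (sym (sameOut≡count D c v))
      (count-⊎ {P = λ u → forward v u ∧ c v ∈ᵖ S u} {Q = λ u → backward v u ∧ (c u ≡ᵇ c v)} split)
      where
      split : ∀ u → T (arc D v u ∧ (c u ≡ᵇ c v)) →
              T (forward v u ∧ c v ∈ᵖ S u) ⊎ T (backward v u ∧ (c u ≡ᵇ c v))
      split u h with to T-∧ h
      ... | a , cu≡cv with arc⇒forward⊎backward v u a
      ...   | inj₁ f =
        inj₁ (from T-∧ (f , subst (λ x → T (x ∈ᵖ S u)) (≡ᵇ⇒≡ (c u) (c v) cu≡cv) (proj₁ (good u))))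
      ...   | inj₂ b = inj₂ (from T-∧ (b , cu≡cv))

    isMajority : ∀ c → (∀ v → GoodColour c v) → IsMajorityColouring D c
    isMajority c good v = begin
      2 * sameOut D c v        ≤⟨ *-monoʳ-≤ 2 (sameOut≤clashes c good v) ⟩
      2 * clashes c v (c v)    ≤⟨ proj₂ (good v) ⟩
      d₁ v + d₂ v              ≤⟨ d₁+d₂≤outDeg v ⟩
      outDeg D v               ∎
      where open ≤-Reasoning

    respectsL : ∀ c → (∀ v → GoodColour c v) → c respects (L , L-injective)
    respectsL c good v with S-good v
    ... | i , j , _ , Sv≡ , _
        with ∈ᵖ⇒≡⊎≡ (L v i , L v j) (subst (λ s → T (c v ∈ᵖ s)) Sv≡ (proj₁ (good v)))
    ...   | inj₁ cv≡ = i , sym cv≡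
    ...   | inj₂ cv≡ = j , sym cv≡

corollary1 : (n : ℕ) (D : Digraph n) → MajorityChoosable 4 D
corollary1 n D (L , L-injective) =
  let open FourLists D L L-injective
      (S , S-good) = choosePairs
      (c , c-good) = chooseColours S S-good
  in c , respectsL S S-good c c-good , isMajority S S-good c c-good
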